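{- Let $G$ be a bipartite graph with vertex bipartition $(A,B)$, and let $C$ be a minimum vertex cover of $G$. Then $C$ is the $A$-K\"onig cover of $G$ if and only if for every minimum vertex cover $C'$ of $G$ we have $A\cap C'\subseteq A\cap C$ and $B\cap C'\supseteq B\cap C$.
   Context: Let $G$ be a bipartite graph with parts $A$ and $B$, and let $M$ be a maximum matching of $G$. A vertex is unsaturated if it is incident with no edge of $M$. An alternating path is a path whose edges alternate between edges not in $M$ and edges in $M$; an alternating path starting in an unsaturated vertex of $A$ thus begins with an edge not in $M$. The $A$-K\"onig cover of $G$ (constructed from $M$) is the vertex set $C$ obtained as follows: for each edge $ab\in M$ with $a\in A$, $b\in B$, if $ab$ lies on an alternating path starting in an unsaturated vertex of $A$, put $b$ into $C$; otherwise put $a$ into $C$. (This set is a minimum vertex cover of $G$.) -}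

module Defs where

open import Data.Nat using (ℕ; _+_; _≤_)
open import Data.Bool using (Bool; true; false; not)
open import Data.Fin using (Fin)
open import Data.Fin.Subset using (Subset; _∈_; ∣_∣)
open import Data.Vec using (tabulate)
open import Data.List using (List; []; _∷_; _++_; map)
open import Data.Nat.ListAction using (sum)
open import Data.List.Relation.Unary.Unique.Propositional using (Unique)
open import Data.Fin using () renaming (_≟_ to _≟F_)
open import Data.Sum using (_⊎_; inj₁; inj₂)
open import Data.Product using (Σ; _×_; _,_; ∃; ∃-syntax; proj₁; proj₂)
open import Data.Unit using (⊤)
open import Data.Empty using (⊥)
open import Relation.Nullary using (¬_)
open import Relation.Binary.PropositionalEquality using (_≡_)
open import Function.Bundles using (_⇔_)
open import Data.List using (allFin)

-- A finite bipartite graph with parts A = Fin m and B = Fin n,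
-- given by its (decidable) bipartite adjacency relation.
BipGraph : ℕ → ℕ → Set
BipGraph m n = Fin m → Fin n → Bool

EdgeSet : ℕ → ℕ → Set
EdgeSet m n = Fin m → Fin n → Bool

edgeCount : ∀ {m n} → EdgeSet m n → ℕ
edgeCount {m} {n} M = sum (map (λ a → ∣ tabulate (M a) ∣) (allFin m))

IsMatching : ∀ {m n} → BipGraph m n → EdgeSet m n → Set
IsMatching {m} {n} G M =
  (∀ a b → M a b ≡ true → G a b ≡ true) ×
  (∀ a b b' → M a b ≡ true → M a b' ≡ true → b ≡ b') ×
  (∀ a a' b → M a b ≡ true → M a' b ≡ true → a ≡ a')

IsMaximumMatching : ∀ {m n} → BipGraph m n → EdgeSet m n → Set
IsMaximumMatching G M =
  IsMatching G M × (∀ M' → IsMatching G M' → edgeCount M' ≤ edgeCount M)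

VSet : ℕ → ℕ → Set
VSet m n = Subset m × Subset n

size : ∀ {m n} → VSet m n → ℕ
size (CA , CB) = ∣ CA ∣ + ∣ CB ∣

IsVertexCover : ∀ {m n} → BipGraph m n → VSet m n → Set
IsVertexCover G (CA , CB) = ∀ a b → G a b ≡ true → a ∈ CA ⊎ b ∈ CB

IsMinimumVertexCover : ∀ {m n} → BipGraph m n → VSet m n → Set
IsMinimumVertexCover G C =
  IsVertexCover G C × (∀ C' → IsVertexCover G C' → size C ≤ size C')

Vertex : ℕ → ℕ → Set
Vertex m n = Fin m ⊎ Fin n

EdgeIn : ∀ {m n} → EdgeSet m n → Vertex m n → Vertex m n → Set
EdgeIn E (inj₁ a) (inj₂ b) = E a b ≡ true
EdgeIn E (inj₂ b) (inj₁ a) = E a b ≡ true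
EdgeIn E _ _ = ⊥

-- Alternating walk condition: the list of vertices is a walk in G whose
-- edges alternate; the Bool says whether the next edge must lie in M.
Alternating : ∀ {m n} → BipGraph m n → EdgeSet m n → Bool → List (Vertex m n) → Set
Alternating G M b [] = ⊤
Alternating G M b (x ∷ []) = ⊤
Alternating G M false (x ∷ y ∷ r) =
  EdgeIn G x y × ¬ EdgeIn M x y × Alternating G M true (y ∷ r)
Alternating G M true (x ∷ y ∷ r) =
  EdgeIn G x y × EdgeIn M x y × Alternating G M false (y ∷ r)

Unsaturated : ∀ {m n} → EdgeSet m n → Fin m → Set
Unsaturated M a = ∀ b → ¬ (M a b ≡ true)

-- Alternating path (distinct vertices) starting at an unsaturated vertex
-- of A; its first edge is therefore not in M.
IsAltPathFromUnsatA : ∀ {m n} → BipGraph m n → EdgeSet m n → List (Vertex m n) → Set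
IsAltPathFromUnsatA G M [] = ⊥
IsAltPathFromUnsatA G M (inj₂ _ ∷ _) = ⊥
IsAltPathFromUnsatA G M p@(inj₁ a ∷ _) =
  Unsaturated M a × Unique p × Alternating G M false p

EdgeOnPath : ∀ {m n} → Vertex m n → Vertex m n → List (Vertex m n) → Set
EdgeOnPath u v p =
  ∃[ xs ] ∃[ ys ] (p ≡ xs ++ u ∷ v ∷ ys ⊎ p ≡ xs ++ v ∷ u ∷ ys)

OnAltPath : ∀ {m n} → BipGraph m n → EdgeSet m n → Fin m → Fin n → Set
OnAltPath G M a b =
  ∃[ p ] (IsAltPathFromUnsatA G M p × EdgeOnPath (inj₁ a) (inj₂ b) p)

IsAKonigCoverFrom : ∀ {m n} → BipGraph m n → EdgeSet m n → VSet m n → Set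
IsAKonigCoverFrom G M (CA , CB) =
  (∀ a → (a ∈ CA) ⇔ (∃[ b ] (M a b ≡ true × ¬ OnAltPath G M a b))) ×
  (∀ b → (b ∈ CB) ⇔ (∃[ a ] (M a b ≡ true × OnAltPath G M a b)))

IsAKonigCover : ∀ {m n} → BipGraph m n → VSet m n → Set
IsAKonigCover G C = ∃[ M ] (IsMaximumMatching G M × IsAKonigCoverFrom G M C)

module Submission where

-- Fix a matching M.  Call a vertex reachable if an M-alternating walk from an
-- unsaturated vertex of A ends in it; an edge ab ∈ M lies on an alternating path from
-- an unsaturated vertex exactly when a (equivalently b) is reachable.  Counting gives
-- weak duality |M| ≤ |C| for every cover C, and if |C| ≤ |M| the cover is tight: C ∩ A
-- is saturated and no edge of M has both ends in C.  Following a walk edge by edge, a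
-- tight cover contains every reachable vertex of B and no reachable vertex of A.
--   (⇒) An A-König cover C built from M is no larger than M, so every minimum cover
--       C' is tight with M, and the rules defining C give the two inclusions.
--   (⇐) Augmenting along alternating paths yields a matching M with no augmenting
--       path.  König's cover K of M (reachable B-vertices, unreachable saturated
--       A-vertices) is a minimum cover, so M is maximum.  The given C is tight with M
--       and squeezed against K, which forces C to be the A-König cover built from M.

open import Defs

open import Data.Bool using (Bool; true; false; not; _∧_; _∨_; if_then_else_)
import Data.Bool.Properties as Bool
open import Data.Bool.Properties using (∧-comm; ∧-identityʳ; ∧-zeroʳ; ∨-identityʳ; ∨-zeroʳ; ¬-not; ⇔→≡)
open import Data.Empty using (⊥; ⊥-elim)
open import Data.Fin using (Fin; zero; suc; join; splitAt)
open import Data.Fin.Properties using (_≟_; any?; all?)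
import Data.Fin.Properties as Fin
open import Data.Fin.Subset using (Subset; _∈_; _⊆_; ∣_∣)
open import Data.List using (List; []; _∷_; _++_; length)
import Data.List as List
import Data.List.Properties as List
open import Data.List.Membership.Propositional using () renaming (_∈_ to _∈ₗ_)
open import Data.List.Membership.Propositional.Properties using (∈-∃++; ∈-lookup; ∈-++⁺ʳ)
open import Data.List.Relation.Unary.All using (All; []; _∷_)
import Data.List.Relation.Unary.All as All
open import Data.List.Relation.Unary.All.Properties using (¬Any⇒All¬)
open import Data.List.Relation.Unary.AllPairs using ([]; _∷_)
open import Data.List.Relation.Unary.Any using (here; there)
open import Data.List.Relation.Unary.Unique.Propositional using (Unique)
open import Data.Nat using (ℕ; zero; suc; _+_; _≤_; z≤n; s≤s)
open import Data.Nat.ListAction using (sum)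
open import Data.Nat.Properties
  using (≤-trans; ≤-reflexive; n≤1+n; 1+n≰n; m≤n⇒m≤1+n; m≤m+n; n≤0⇒n≡0; +-mono-≤; +-monoˡ-≤;
         +-monoʳ-≤; +-cancelˡ-≤; +-suc; +-identityʳ; suc-injective; m+n≡0⇒m≡0; m+n≡0⇒n≡0;
         module ≤-Reasoning)
open import Data.Nat.Tactic.RingSolver using (solve-∀)
open import Data.Product using (∃; ∃-syntax; _×_; _,_; proj₁; proj₂)
open import Data.Sum using (_⊎_; inj₁; inj₂)
import Data.Sum.Properties as Sum
open import Data.Unit using (⊤; tt)
open import Data.Vec using (lookup; tabulate; _∷_; [])
import Data.Vec.Properties as Vec
open import Function using (case_of_; _∘_; id)
open import Function.Bundles using (Equivalence; mk⇔; _⇔_)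
open import Relation.Binary.PropositionalEquality
open import Relation.Nullary using (¬_; Dec; yes; no; does)
open import Relation.Nullary.Decidable using (_×-dec_; ¬?; map′; dec-true; dec-false)

∧-true⁻ : ∀ {x y} → x ∧ y ≡ true → x ≡ true × y ≡ true
∧-true⁻ {true} {true} _ = refl , refl

∧-true⁺ : ∀ {x y} → x ≡ true → y ≡ true → x ∧ y ≡ true
∧-true⁺ refl refl = refl

not-true⁻ : ∀ {x} → not x ≡ true → ¬ x ≡ true
not-true⁻ {false} _ ()

not-true⁺ : ∀ {x} → ¬ x ≡ true → not x ≡ true
not-true⁺ x≢true = cong not (¬-not x≢true)

indicator : Bool → ℕ
indicator true  = 1
indicator false = 0

count : ∀ {k} → (Fin k → Bool) → ℕ
count {zero}  f = 0
count {suc k} f = indicator (f zero) + count (λ i → f (suc i))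

count-cong : ∀ {k} {f g : Fin k → Bool} → (∀ i → f i ≡ g i) → count f ≡ count g
count-cong {zero}  e = refl
count-cong {suc k} e = cong₂ _+_ (cong indicator (e zero)) (count-cong (λ i → e (suc i)))

count-≤ : ∀ {k} (f : Fin k → Bool) → count f ≤ k
count-≤ {zero}  f = z≤n
count-≤ {suc k} f with f zero
... | true  = s≤s (count-≤ _)
... | false = m≤n⇒m≤1+n (count-≤ _)

count-mono : ∀ {k} {f g : Fin k → Bool} → (∀ i → f i ≡ true → g i ≡ true) → count f ≤ count g
count-mono {zero}          h = z≤n
count-mono {suc k} {f} {g} h with f zero in f₀ | g zero in g₀
... | true  | true  = s≤s (count-mono (λ i → h (suc i)))
... | true  | false with () ← trans (sym (h zero f₀)) g₀
... | false | true  = m≤n⇒m≤1+n (count-mono (λ i → h (suc i)))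
... | false | false = count-mono (λ i → h (suc i))

count-split : ∀ {k} (f g : Fin k → Bool) →
  count f ≡ count (λ i → f i ∧ g i) + count (λ i → f i ∧ not (g i))
count-split {zero}  f g = refl
count-split {suc k} f g with f zero | g zero
... | false | _     = count-split (λ i → f (suc i)) (λ i → g (suc i))
... | true  | true  = cong suc (count-split (λ i → f (suc i)) (λ i → g (suc i)))
... | true  | false = trans (cong suc (count-split (λ i → f (suc i)) (λ i → g (suc i)))) (sym (+-suc _ _))

count-none : ∀ {k} {f : Fin k → Bool} → (∀ i → ¬ f i ≡ true) → count f ≡ 0
count-none {zero}      h = refl
count-none {suc k} {f} h with f zero in f₀
... | true  = ⊥-elim (h zero f₀)
... | false = count-none (λ i → h (suc i))

count-zero : ∀ {k} {f : Fin k → Bool} → count f ≡ 0 → ∀ i → ¬ f i ≡ true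
count-zero {suc k} {f} c i p with f zero in f₀
count-zero {suc k} {f} () i p       | true
count-zero {suc k} {f} c zero p     | false = case trans (sym f₀) p of λ ()
count-zero {suc k} {f} c (suc i) p  | false = count-zero c i p

_without_ : ∀ {k} → (Fin k → Bool) → Fin k → Fin k → Bool
(f without j) i = f i ∧ not (does (i ≟ j))

without-self : ∀ {k} (f : Fin k → Bool) j → (f without j) j ≡ false
without-self f j = trans (cong (λ d → f j ∧ not d) (dec-true (j ≟ j) refl)) (∧-zeroʳ (f j))

without-other : ∀ {k} (f : Fin k → Bool) {j} i → ¬ i ≡ j → (f without j) i ≡ f i
without-other f {j} i i≢j = trans (cong (λ d → f i ∧ not d) (dec-false (i ≟ j) i≢j)) (∧-identityʳ (f i))

without-true : ∀ {k} (f : Fin k → Bool) {j} i → (f without j) i ≡ true → f i ≡ true × ¬ i ≡ j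
without-true f {j} i p with f i | i ≟ j | p
... | true | no i≢j | _ = refl , i≢j

count-insert : ∀ {k} {f g : Fin k → Bool} j → f j ≡ false → g j ≡ true →
  (∀ i → ¬ i ≡ j → f i ≡ g i) → count g ≡ suc (count f)
count-insert {suc k} {f} {g} zero f₀ g₀ h rewrite f₀ | g₀ =
  cong suc (count-cong (λ i → sym (h (suc i) λ ())))
count-insert {suc k} {f} {g} (suc j) fⱼ gⱼ h =
  trans (cong₂ _+_ (cong indicator (sym (h zero λ ())))
                   (count-insert j fⱼ gⱼ (λ i i≢j → h (suc i) (i≢j ∘ Fin.suc-injective))))
        (+-suc _ _)

count-swap : ∀ {k} {f g : Fin k → Bool} i j → f i ≡ false → g i ≡ true → f j ≡ true → g j ≡ false →
  (∀ x → ¬ x ≡ i → ¬ x ≡ j → f x ≡ g x) → count f ≡ count g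
count-swap {f = f} {g} i j fᵢ gᵢ fⱼ gⱼ h =
  suc-injective (trans (sym (count-insert i fᵢ with-i f≗)) (count-insert j gⱼ with-j g≗))
  where
    f∪i : Fin _ → Bool
    f∪i x = f x ∨ does (x ≟ i)
    with-i : f∪i i ≡ true
    with-i = trans (cong (f i ∨_) (dec-true (i ≟ i) refl)) (∨-zeroʳ (f i))
    f≗ : ∀ x → ¬ x ≡ i → f x ≡ f∪i x
    f≗ x x≢i = sym (trans (cong (f x ∨_) (dec-false (x ≟ i) x≢i)) (∨-identityʳ (f x)))
    with-j : f∪i j ≡ true
    with-j = cong (_∨ does (j ≟ i)) fⱼ
    g≗ : ∀ x → ¬ x ≡ j → g x ≡ f x ∨ does (x ≟ i)
    g≗ x x≢j with x ≟ i
    ... | yes refl = trans gᵢ (sym (∨-zeroʳ (f x)))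
    ... | no x≢i   = trans (sym (h x x≢i x≢j)) (sym (∨-identityʳ (f x)))

count-inj : ∀ {k l} {P : Fin k → Bool} {Q : Fin l → Bool} (R : Fin k → Fin l → Set) →
  (∀ i → P i ≡ true → ∃[ j ] (R i j × Q j ≡ true)) →
  (∀ i i' j → R i j → R i' j → i ≡ i') → count P ≤ count Q
count-inj {zero}          R img inj = z≤n
count-inj {suc k} {P = P} {Q} R img inj with P zero in p₀
... | false = count-inj (λ i → R (suc i)) (λ i → img (suc i)) injˢ
  where injˢ = λ i i' j r r' → Fin.suc-injective (inj (suc i) (suc i') j r r')
... | true with img zero p₀
...   | j₀ , r₀ , q₀ = begin
  suc (count (λ i → P (suc i))) ≤⟨ s≤s (count-inj (λ i → R (suc i)) imgˢ injˢ) ⟩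
  suc (count (Q without j₀))    ≡⟨ sym (count-insert j₀ (without-self Q j₀) q₀ (without-other Q)) ⟩
  count Q                       ∎
  where
    open ≤-Reasoning
    injˢ = λ i i' j r r' → Fin.suc-injective (inj (suc i) (suc i') j r r')
    imgˢ : ∀ i → P (suc i) ≡ true → ∃[ j ] (R (suc i) j × (Q without j₀) j ≡ true)
    imgˢ i p with img (suc i) p
    ... | j , r , q = j , r , trans (without-other Q j j≢j₀) q
      where
        j≢j₀ : ¬ j ≡ j₀
        j≢j₀ refl with () ← inj (suc i) zero j r r₀

dec-true⁻ : ∀ {P : Set} (d : Dec P) → does d ≡ true → P
dec-true⁻ (yes p) _ = p

anyB : ∀ {k} → (Fin k → Bool) → Bool
anyB f = does (any? (λ i → f i Bool.≟ true))

anyB-intro : ∀ {k} {f : Fin k → Bool} i → f i ≡ true → anyB f ≡ true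
anyB-intro i p = dec-true (any? _) (i , p)

anyB-elim : ∀ {k} {f : Fin k → Bool} → anyB f ≡ true → ∃[ i ] f i ≡ true
anyB-elim {f = f} e with any? (λ i → f i Bool.≟ true)
... | yes p = p

anyB-none : ∀ {k} {f : Fin k → Bool} → (∀ i → ¬ f i ≡ true) → anyB f ≡ false
anyB-none h = dec-false (any? _) (λ (i , p) → h i p)

anyB-cong : ∀ {k} {f g : Fin k → Bool} → (∀ i → f i ≡ g i) → anyB f ≡ anyB g
anyB-cong {f = f} {g} e = ⇔→≡ (mk⇔ (transport e) (transport (sym ∘ e)))
  where
    transport : ∀ {f g : Fin _ → Bool} → (∀ i → f i ≡ g i) → anyB f ≡ true → anyB g ≡ true
    transport e p with anyB-elim p
    ... | i , q = anyB-intro i (trans (sym (e i)) q)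

count-subsingleton : ∀ {k} {f : Fin k → Bool} →
  (∀ i j → f i ≡ true → f j ≡ true → i ≡ j) → count f ≡ indicator (anyB f)
count-subsingleton {f = f} single with anyB f in e
... | false = count-none {f = f} (λ i p → case trans (sym e) (anyB-intro i p) of λ ())
... | true with anyB-elim e
...   | j , p = trans (count-insert j (without-self f j) p (without-other f))
                      (cong suc (count-none only-j))
  where
    only-j : ∀ i → ¬ (f without j) i ≡ true
    only-j i q with without-true f i q
    ... | fᵢ , i≢j = i≢j (single i j fᵢ p)

∈⇒lookup : ∀ {k} {p : Subset k} {i} → i ∈ p → lookup p i ≡ true
∈⇒lookup = Vec.[]=⇒lookup

lookup⇒∈ : ∀ {k} {p : Subset k} {i} → lookup p i ≡ true → i ∈ p
lookup⇒∈ {p = p} {i} = Vec.lookup⇒[]= i p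

∈-tabulate : ∀ {k} {f : Fin k → Bool} {i} → i ∈ tabulate f → f i ≡ true
∈-tabulate {f = f} {i} i∈ = trans (sym (Vec.lookup∘tabulate f i)) (∈⇒lookup i∈)

tabulate-∈ : ∀ {k} {f : Fin k → Bool} {i} → f i ≡ true → i ∈ tabulate f
tabulate-∈ {f = f} {i} p = lookup⇒∈ (trans (Vec.lookup∘tabulate f i) p)

card-count : ∀ {k} (p : Subset k) → ∣ p ∣ ≡ count (lookup p)
card-count []          = refl
card-count (true ∷ p)  = cong suc (card-count p)
card-count (false ∷ p) = card-count p

size-count : ∀ {m n} (C : VSet m n) → size C ≡ count (lookup (proj₁ C)) + count (lookup (proj₂ C))
size-count (CA , CB) = cong₂ _+_ (card-count CA) (card-count CB)

sum-indicators : ∀ {k} (h : Fin k → ℕ) (f : Fin k → Bool) →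
  (∀ i → h i ≡ indicator (f i)) → sum (List.tabulate h) ≡ count f
sum-indicators {zero}  h f e = refl
sum-indicators {suc k} h f e = cong₂ _+_ (e zero) (sum-indicators (h ∘ suc) (f ∘ suc) (e ∘ suc))

saturated : ∀ {m n} → EdgeSet m n → Fin m → Bool
saturated M a = anyB (M a)

matchSize : ∀ {m n} → EdgeSet m n → ℕ
matchSize M = count (saturated M)

module Duality {m n : ℕ} (G : BipGraph m n) where

  -- In a matching every row has at most one edge, so edges and saturated vertices agree.
  edgeCount≡matchSize : ∀ {M} → IsMatching G M → edgeCount M ≡ matchSize M
  edgeCount≡matchSize {M} (_ , rows , _) = begin
    sum (List.map row (List.allFin m)) ≡⟨ cong sum (List.map-tabulate id row) ⟩
    sum (List.tabulate row)            ≡⟨ sum-indicators row (saturated M) row-size ⟩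
    matchSize M                        ∎
    where
      open ≡-Reasoning
      row : Fin m → ℕ
      row a = ∣ tabulate (M a) ∣
      row-size : ∀ a → row a ≡ indicator (saturated M a)
      row-size a = trans (card-count (tabulate (M a)))
        (trans (count-cong (Vec.lookup∘tabulate (M a))) (count-subsingleton (rows a)))

  idle : EdgeSet m n → VSet m n → Fin m → Bool
  idle M (CA , CB) a = lookup CA a ∧ not (saturated M a)

  doubled : EdgeSet m n → VSet m n → Fin m → Bool
  doubled M (CA , CB) a = anyB (λ b → M a b ∧ lookup CB b) ∧ lookup CA a

  -- Weak duality with its defect: charge each saturated a to itself if a ∈ C and to
  -- its partner (which then lies in C) otherwise.
  duality-defect : ∀ {M} {C : VSet m n} → IsMatching G M → IsVertexCover G C →
    matchSize M + (count (idle M C) + count (doubled M C)) ≤ size C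
  duality-defect {M} {C@(CA , CB)} (inG , _ , cols) cov = begin
    count f + (x + y)
      ≡⟨ cong (_+ (x + y)) (count-split f inA) ⟩
    (count (λ a → f a ∧ inA a) + count (λ a → f a ∧ not (inA a))) + (x + y)
      ≤⟨ +-monoˡ-≤ (x + y) (+-mono-≤ (≤-reflexive (count-cong (λ a → ∧-comm (f a) (inA a))))
                                     (count-mono partner-in-C)) ⟩
    (count (λ a → inA a ∧ f a) + count (λ a → T a ∧ not (inA a))) + (x + y)
      ≡⟨ interchange (count (λ a → inA a ∧ f a)) (count (λ a → T a ∧ not (inA a))) x y ⟩
    (count (λ a → inA a ∧ f a) + x) + (y + count (λ a → T a ∧ not (inA a)))
      ≡⟨ cong₂ _+_ (count-split inA f) (count-split T inA) ⟨
    count inA + count T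
      ≤⟨ +-monoʳ-≤ (count inA) (count-inj (λ a b → M a b ≡ true) T-partner
                                          (λ a a' b p q → cols a a' b p q)) ⟩
    count inA + count inB
      ≡⟨ size-count C ⟨
    size C ∎
    where
      open ≤-Reasoning
      f = saturated M
      inA = lookup CA
      inB = lookup CB
      x = count (idle M C)
      y = count (doubled M C)
      T : Fin m → Bool
      T a = anyB (λ b → M a b ∧ inB b)
      interchange : ∀ p q x y → (p + q) + (x + y) ≡ (p + x) + (y + q)
      interchange = solve-∀
      partner-in-C : ∀ a → f a ∧ not (inA a) ≡ true → T a ∧ not (inA a) ≡ true
      partner-in-C a p with ∧-true⁻ p
      ... | sat , a∉ with anyB-elim sat
      ...   | b , ab∈M with cov a b (inG a b ab∈M)
      ...     | inj₁ a∈ = ⊥-elim (not-true⁻ a∉ (∈⇒lookup a∈))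
      ...     | inj₂ b∈ = ∧-true⁺ (anyB-intro b (∧-true⁺ ab∈M (∈⇒lookup b∈))) a∉
      T-partner : ∀ a → T a ≡ true → ∃[ b ] (M a b ≡ true × inB b ≡ true)
      T-partner a p with anyB-elim p
      ... | b , q = b , ∧-true⁻ q

  weak-duality : ∀ {M} {C : VSet m n} → IsMatching G M → IsVertexCover G C → matchSize M ≤ size C
  weak-duality {M} mat cov = ≤-trans (m≤m+n (matchSize M) _) (duality-defect mat cov)

  Tight : EdgeSet m n → VSet m n → Set
  Tight M (CA , CB) =
    (∀ a → a ∈ CA → ∃[ b ] M a b ≡ true) × (∀ a b → M a b ≡ true → a ∈ CA → b ∈ CB → ⊥)

  -- A cover no larger than a matching is tight with it: both defects must vanish.
  tight : ∀ {M} {C : VSet m n} → IsMatching G M → IsVertexCover G C → size C ≤ matchSize M → Tight M C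
  tight {M} {C@(CA , CB)} mat cov small = saturates , separates
    where
      no-defect : count (idle M C) + count (doubled M C) ≡ 0
      no-defect = n≤0⇒n≡0 (+-cancelˡ-≤ (matchSize M) _ 0
        (≤-trans (duality-defect mat cov) (≤-trans small (≤-reflexive (sym (+-identityʳ _))))))
      saturates : ∀ a → a ∈ CA → ∃[ b ] M a b ≡ true
      saturates a a∈ with saturated M a in sat
      ... | true  = anyB-elim sat
      ... | false = ⊥-elim (count-zero (m+n≡0⇒m≡0 _ no-defect) a (∧-true⁺ (∈⇒lookup a∈) (cong not sat)))
      separates : ∀ a b → M a b ≡ true → a ∈ CA → b ∈ CB → ⊥
      separates a b ab∈M a∈ b∈ = count-zero (m+n≡0⇒n≡0 (count (idle M C)) no-defect) a
        (∧-true⁺ (anyB-intro b (∧-true⁺ ab∈M (∈⇒lookup b∈))) (∈⇒lookup a∈))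

  matched-bound : ∀ {M} {C : VSet m n} → IsMatching G M →
    (∀ a → a ∈ proj₁ C → ∃[ b ] M a b ≡ true) →
    (∀ b → b ∈ proj₂ C → ∃[ a ] (M a b ≡ true × ¬ a ∈ proj₁ C)) → size C ≤ matchSize M
  matched-bound {M} {C@(CA , CB)} (_ , rows , _) satA mateB = begin
    size C                        ≡⟨ size-count C ⟩
    count inA + count (lookup CB) ≤⟨ +-mono-≤ (count-mono in-f) (count-inj (λ b a → M a b ≡ true) partner
                                                               (λ b b' a p q → rows a b b' p q)) ⟩
    count (λ a → f a ∧ inA a) + count (λ a → f a ∧ not (inA a)) ≡⟨ sym (count-split f inA) ⟩
    matchSize M                   ∎
    where
      open ≤-Reasoning
      f = saturated M
      inA = lookup CA
      in-f : ∀ a → inA a ≡ true → f a ∧ inA a ≡ true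
      in-f a p with satA a (lookup⇒∈ p)
      ... | b , ab∈M = ∧-true⁺ (anyB-intro b ab∈M) p
      partner : ∀ b → lookup CB b ≡ true → ∃[ a ] (M a b ≡ true × f a ∧ not (inA a) ≡ true)
      partner b p with mateB b (lookup⇒∈ p)
      ... | a , ab∈M , a∉ = a , ab∈M , ∧-true⁺ (anyB-intro b ab∈M) (not-true⁺ (a∉ ∘ lookup⇒∈))

module Walks {m n : ℕ} (G : BipGraph m n) where

  V : Set
  V = Vertex m n

  _≟V_ : (x y : V) → Dec (x ≡ y)
  _≟V_ = Sum.≡-dec _≟_ _≟_

  open import Data.List.Membership.DecPropositional _≟V_ using (_∈?_)

  some-vertex? : {P : V → Set} → (∀ v → Dec (P v)) → Dec (∃ P)
  some-vertex? P? with any? (P? ∘ inj₁) | any? (P? ∘ inj₂)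
  ... | yes (a , p) | _           = yes (inj₁ a , p)
  ... | no _        | yes (b , p) = yes (inj₂ b , p)
  ... | no ¬A       | no ¬B       = no λ { (inj₁ a , p) → ¬A (a , p) ; (inj₂ b , p) → ¬B (b , p) }

  Step : EdgeSet m n → V → V → Set
  Step M (inj₁ a) (inj₂ b) = G a b ≡ true × ¬ M a b ≡ true
  Step M (inj₂ b) (inj₁ a) = G a b ≡ true × M a b ≡ true
  Step M (inj₁ _) (inj₁ _) = ⊥
  Step M (inj₂ _) (inj₂ _) = ⊥

  step? : ∀ M x y → Dec (Step M x y)
  step? M (inj₁ a) (inj₂ b) = (G a b Bool.≟ true) ×-dec ¬? (M a b Bool.≟ true)
  step? M (inj₂ b) (inj₁ a) = (G a b Bool.≟ true) ×-dec (M a b Bool.≟ true)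
  step? M (inj₁ _) (inj₁ _) = no λ ()
  step? M (inj₂ _) (inj₂ _) = no λ ()

  -- Walk M k x z: an alternating walk of at most k steps from x to z.
  data Walk (M : EdgeSet m n) : ℕ → V → V → Set where
    []  : ∀ {k x} → Walk M k x x
    _∷_ : ∀ {k x y z} → Step M x y → Walk M k y z → Walk M (suc k) x z

  walk-weaken : ∀ {M k k' x z} → k ≤ k' → Walk M k x z → Walk M k' x z
  walk-weaken _         []       = []
  walk-weaken (s≤s k≤k') (s ∷ w) = s ∷ walk-weaken k≤k' w

  walk-snoc : ∀ {M k x y z} → Walk M k x y → Step M y z → Walk M (suc k) x z
  walk-snoc []      s = s ∷ []
  walk-snoc (t ∷ w) s = t ∷ walk-snoc w s

  walk-last : ∀ {M k x z} → Walk M k x z → x ≡ z ⊎ ∃[ y ] ∃[ k' ] (Walk M k' x y × Step M y z)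
  walk-last []      = inj₁ refl
  walk-last (s ∷ w) with walk-last w
  ... | inj₁ refl               = inj₂ (_ , 0 , [] , s)
  ... | inj₂ (y , k' , w' , s') = inj₂ (y , suc k' , s ∷ w' , s')

  walk? : ∀ M k x z → Dec (Walk M k x z)
  walk? M k x z with x ≟V z
  ... | yes refl = yes []
  walk? M zero    x z | no x≢z = no λ { [] → x≢z refl }
  walk? M (suc k) x z | no x≢z =
    map′ (λ (y , s , w) → s ∷ w) first-step (some-vertex? (λ y → step? M x y ×-dec walk? M k y z))
    where
      first-step : Walk M (suc k) x z → ∃[ y ] (Step M x y × Walk M k y z)
      first-step []      = ⊥-elim (x≢z refl)
      first-step (s ∷ w) = _ , s , w

  Reachable : EdgeSet m n → V → Set
  Reachable M z = ∃[ a₀ ] (Unsaturated M a₀ × ∃[ k ] Walk M k (inj₁ a₀) z)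

  -- The same with walks of at most m + n steps; this form is decidable.
  ReachableWithin : EdgeSet m n → V → Set
  ReachableWithin M z = ∃[ a₀ ] (Unsaturated M a₀ × Walk M (m + n) (inj₁ a₀) z)

  reachable-within? : ∀ M z → Dec (ReachableWithin M z)
  reachable-within? M z =
    any? (λ a₀ → all? (λ b → ¬? (M a₀ b Bool.≟ true)) ×-dec walk? M (m + n) (inj₁ a₀) z)

  reachable-step : ∀ {M x y} → Reachable M x → Step M x y → Reachable M y
  reachable-step (a₀ , u , k , w) s = a₀ , u , suc k , walk-snoc w s

  -- Any walk reaching a saturated A-vertex enters it along its matching edge.
  mate-reachable : ∀ {M a b} → IsMatching G M → Reachable M (inj₁ a) → M a b ≡ true →
    Reachable M (inj₂ b)
  mate-reachable (_ , rows , _) (a₀ , u , k , w) ab∈M with walk-last w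
  ... | inj₁ refl                                  = ⊥-elim (u _ ab∈M)
  ... | inj₂ (inj₂ b' , k' , w' , (_ , ab'∈M)) with rows _ _ _ ab'∈M ab∈M
  ...   | refl = a₀ , u , k' , w'

  Steps : EdgeSet m n → List V → Set
  Steps M []          = ⊤
  Steps M (x ∷ [])    = ⊤
  Steps M (x ∷ y ∷ r) = Step M x y × Steps M (y ∷ r)

  EndsAt : V → List V → Set
  EndsAt z []          = ⊥
  EndsAt z (x ∷ [])    = x ≡ z
  EndsAt z (x ∷ y ∷ r) = EndsAt z (y ∷ r)

  AltPath : EdgeSet m n → V → V → List V → Set
  AltPath M x z r = Steps M (x ∷ r) × EndsAt z (x ∷ r) × Unique (x ∷ r)

  endsAt-member : ∀ {z} xs → EndsAt z xs → z ∈ₗ xs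
  endsAt-member (x ∷ [])    refl = here refl
  endsAt-member (x ∷ y ∷ r) e    = there (endsAt-member (y ∷ r) e)

  steps-suffix : ∀ {M} xs ys → Steps M (xs ++ ys) → Steps M ys
  steps-suffix []           ys       s       = s
  steps-suffix (x ∷ [])     []       s       = tt
  steps-suffix (x ∷ [])     (y ∷ ys) (_ , s) = s
  steps-suffix (x ∷ x' ∷ xs) ys      (_ , s) = steps-suffix (x' ∷ xs) ys s

  endsAt-suffix : ∀ {z} xs y ys → EndsAt z (xs ++ y ∷ ys) → EndsAt z (y ∷ ys)
  endsAt-suffix []            y ys e = e
  endsAt-suffix (x ∷ [])      y ys e = e
  endsAt-suffix (x ∷ x' ∷ xs) y ys e = endsAt-suffix (x' ∷ xs) y ys e

  unique-suffix : ∀ (xs ys : List V) → Unique (xs ++ ys) → Unique ys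
  unique-suffix []       ys u       = u
  unique-suffix (x ∷ xs) ys (_ ∷ u) = unique-suffix xs ys u

  walk→steps : ∀ {M k x z} → Walk M k x z → ∃[ r ] (Steps M (x ∷ r) × EndsAt z (x ∷ r))
  walk→steps []                 = [] , tt , refl
  walk→steps (_∷_ {y = y} s w) with walk→steps w
  ... | r , ss , e = y ∷ r , (s , ss) , e

  steps→walk : ∀ {M z} x r → Steps M (x ∷ r) → EndsAt z (x ∷ r) → Walk M (length r) x z
  steps→walk x []      _        refl = []
  steps→walk x (y ∷ r) (s , ss) e    = s ∷ steps→walk y r ss e

  -- Cutting out the cycles of a walk leaves a path: if the start x recurs later,
  -- keep only the part after its last occurrence.
  shorten : ∀ {M z} x q → Steps M (x ∷ q) → EndsAt z (x ∷ q) → ∃[ r ] AltPath M x z r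
  shorten x []      _        e = [] , tt , e , [] ∷ []
  shorten x (y ∷ q) (s , ss) e with shorten y q ss e
  ... | r , ss' , e' , u with x ∈? (y ∷ r)
  ...   | no x∉ = y ∷ r , (s , ss') , e' , ¬Any⇒All¬ (y ∷ r) x∉ ∷ u
  ...   | yes x∈ with ∈-∃++ x∈
  ...     | xs , ys , split =
    ys , steps-suffix xs (x ∷ ys) (subst (Steps _) split ss') ,
    endsAt-suffix xs x ys (subst (EndsAt _) split e') , unique-suffix xs (x ∷ ys) (subst Unique split u)

  walk→path : ∀ {M k x z} → Walk M k x z → ∃[ r ] AltPath M x z r
  walk→path w with walk→steps w
  ... | r , ss , e = shorten _ r ss e

  unique-length : ∀ (xs : List V) → Unique xs → length xs ≤ m + n
  unique-length xs u = Fin.injective⇒≤ {f = encode ∘ List.lookup xs}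
    (λ {i} {j} e → lookup-injective xs u i j (encode-injective e))
    where
      encode : V → Fin (m + n)
      encode = join m n
      encode-injective : ∀ {x y} → encode x ≡ encode y → x ≡ y
      encode-injective {x} {y} e =
        trans (sym (Fin.splitAt-join m n x)) (trans (cong (splitAt m) e) (Fin.splitAt-join m n y))
      lookup-injective : ∀ (xs : List V) → Unique xs → ∀ i j → List.lookup xs i ≡ List.lookup xs j → i ≡ j
      lookup-injective (x ∷ xs) (x∉ ∷ u) zero    zero    e = refl
      lookup-injective (x ∷ xs) (x∉ ∷ u) zero    (suc j) e = ⊥-elim (All.lookup x∉ (∈-lookup j) e)
      lookup-injective (x ∷ xs) (x∉ ∷ u) (suc i) zero    e = ⊥-elim (All.lookup x∉ (∈-lookup i) (sym e))
      lookup-injective (x ∷ xs) (x∉ ∷ u) (suc i) (suc j) e = cong suc (lookup-injective xs u i j e)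

  -- A path has fewer than m + n steps, so reachability needs no longer walks.
  path→walk : ∀ {M x z r} → AltPath M x z r → Walk M (m + n) x z
  path→walk {x = x} {r = r} (ss , e , u) =
    walk-weaken (≤-trans (n≤1+n (length r)) (unique-length (x ∷ r) u)) (steps→walk x r ss e)

  reachable-within : ∀ {M z} → Reachable M z → ReachableWithin M z
  reachable-within (a₀ , u , k , w) = a₀ , u , path→walk (proj₂ (walk→path w))

  -- The side of a vertex: whether the edge leaving it in an alternating walk lies in M.
  side : V → Bool
  side (inj₁ _) = false
  side (inj₂ _) = true

  steps→alternating : ∀ {M} x r → Steps M (x ∷ r) → Alternating G M (side x) (x ∷ r)
  steps→alternating x        []          _               = tt
  steps→alternating (inj₁ a) (inj₂ b ∷ r) ((g , ∉M) , ss) = g , ∉M , steps→alternating (inj₂ b) r ss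
  steps→alternating (inj₂ b) (inj₁ a ∷ r) ((g , ∈M) , ss) = g , ∈M , steps→alternating (inj₁ a) r ss
  steps→alternating (inj₁ a) (inj₁ _ ∷ r) (() , _)
  steps→alternating (inj₂ b) (inj₂ _ ∷ r) (() , _)

  alternating→steps : ∀ {M} x r → Alternating G M (side x) (x ∷ r) → Steps M (x ∷ r)
  alternating→steps x        []          _              = tt
  alternating→steps (inj₁ a) (inj₂ b ∷ r) (g , ∉M , alt) = (g , ∉M) , alternating→steps (inj₂ b) r alt
  alternating→steps (inj₂ b) (inj₁ a ∷ r) (g , ∈M , alt) = (g , ∈M) , alternating→steps (inj₁ a) r alt
  alternating→steps (inj₁ a) (inj₁ _ ∷ r) (() , _)
  alternating→steps (inj₂ b) (inj₂ _ ∷ r) (() , _)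

  walk-to-member : ∀ {M y} x r → Steps M (x ∷ r) → y ∈ₗ x ∷ r → ∃[ k ] Walk M k x y
  walk-to-member x r        ss       (here refl) = 0 , []
  walk-to-member x (x' ∷ r) (s , ss) (there y∈)  with walk-to-member x' r ss y∈
  ... | k , w = suc k , s ∷ w

  edge-members : ∀ {u v : V} p → EdgeOnPath u v p → u ∈ₗ p × v ∈ₗ p
  edge-members _ (xs , ys , inj₁ refl) = ∈-++⁺ʳ xs (here refl) , ∈-++⁺ʳ xs (there (here refl))
  edge-members _ (xs , ys , inj₂ refl) = ∈-++⁺ʳ xs (there (here refl)) , ∈-++⁺ʳ xs (here refl)

  onAltPath⇒reachable : ∀ {M a b} → OnAltPath G M a b → Reachable M (inj₁ a) × Reachable M (inj₂ b)
  onAltPath⇒reachable (inj₁ a₀ ∷ r , (u , _ , alt) , on) =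
    reach (proj₁ (edge-members _ on)) , reach (proj₂ (edge-members _ on))
    where
      reach : ∀ {y} → y ∈ₗ inj₁ a₀ ∷ r → Reachable _ y
      reach y∈ = a₀ , u , walk-to-member (inj₁ a₀) r (alternating→steps (inj₁ a₀) r alt) y∈

  final-step : ∀ {M z} x y r → Steps M (x ∷ y ∷ r) → EndsAt z (x ∷ y ∷ r) →
    ∃[ xs ] ∃[ y' ] (x ∷ y ∷ r ≡ xs ++ y' ∷ z ∷ [] × Step M y' z)
  final-step x y []      (s , _)  refl = [] , x , refl , s
  final-step x y (w ∷ r) (_ , ss) e    with final-step y w r ss e
  ... | xs , y' , split , s = x ∷ xs , y' , cong (x ∷_) split , s

  -- Conversely, a path reaching a saturated A-vertex a arrives through its matching
  -- edge, which therefore lies on an alternating path.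
  reachable⇒onAltPath : ∀ {M a b} → IsMatching G M → Reachable M (inj₁ a) → M a b ≡ true →
    OnAltPath G M a b
  reachable⇒onAltPath {M} {a} {b} (_ , rows , _) (a₀ , u , k , w) ab∈M with walk→path w
  ... | [] , _ , refl , _ = ⊥-elim (u b ab∈M)
  ... | y ∷ r , ss , e , uniq with final-step (inj₁ a₀) y r ss e
  ...   | xs , inj₂ b' , split , (_ , ab'∈M) with rows a b' b ab'∈M ab∈M
  ...     | refl = inj₁ a₀ ∷ y ∷ r , (u , uniq , steps→alternating (inj₁ a₀) (y ∷ r) ss) ,
                   xs , [] , inj₂ split

module TightCovers {m n : ℕ} (G : BipGraph m n) where
  open Duality G
  open Walks G

  Separated : VSet m n → V → Set
  Separated (CA , CB) (inj₁ a) = ¬ a ∈ CA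
  Separated (CA , CB) (inj₂ b) = b ∈ CB

  -- Steps preserve separation: an edge leaving A ∖ C is covered at its B-end, and by
  -- tightness an edge of M leaving B ∩ C ends outside C.
  separated-walk : ∀ {M C k x z} → Tight M C → IsVertexCover G C → Walk M k x z →
    Separated C x → Separated C z
  separated-walk t cov [] sep = sep
  separated-walk {x = inj₁ a} t cov (_∷_ {y = inj₂ b} (g , _) w) a∉ with cov a b g
  ... | inj₁ a∈ = ⊥-elim (a∉ a∈)
  ... | inj₂ b∈ = separated-walk t cov w b∈
  separated-walk {x = inj₂ b} t@(_ , apart) cov (_∷_ {y = inj₁ a} (_ , ab∈M) w) b∈ =
    separated-walk t cov w (λ a∈ → apart a b ab∈M a∈ b∈)

  -- Walks start at unsaturated vertices, which a tight cover omits; so every reachable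
  -- vertex is separated.
  tight-reachable : ∀ {M C z} → Tight M C → IsVertexCover G C → Reachable M z → Separated C z
  tight-reachable t@(saturates , _) cov (a₀ , u , k , w) =
    separated-walk t cov w λ a₀∈ → u (proj₁ (saturates a₀ a₀∈)) (proj₂ (saturates a₀ a₀∈))

  tight-A : ∀ {M C a} → Tight M C → IsVertexCover G C → a ∈ proj₁ C →
    ∃[ b ] (M a b ≡ true × ¬ OnAltPath G M a b)
  tight-A t@(saturates , _) cov a∈ with saturates _ a∈
  ... | b , ab∈M = b , ab∈M , λ on → tight-reachable t cov (proj₁ (onAltPath⇒reachable on)) a∈

  tight-B : ∀ {M C a b} → Tight M C → IsVertexCover G C → OnAltPath G M a b → b ∈ proj₂ C
  tight-B t cov on = tight-reachable t cov (proj₂ (onAltPath⇒reachable on))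

module Augmentation {m n : ℕ} (G : BipGraph m n) where
  open Walks G

  UnsaturatedB : EdgeSet m n → Fin n → Set
  UnsaturatedB M b = ∀ a → ¬ M a b ≡ true

  rematch : EdgeSet m n → Fin m → Fin n → EdgeSet m n
  rematch M a₀ b a b' = if does (b' ≟ b) then does (a ≟ a₀) else M a b'

  rematch-at : ∀ M a₀ b a → rematch M a₀ b a b ≡ does (a ≟ a₀)
  rematch-at M a₀ b a rewrite dec-true (b ≟ b) refl = refl

  rematch-off : ∀ M a₀ {b} a b' → ¬ b' ≡ b → rematch M a₀ b a b' ≡ M a b'
  rematch-off M a₀ {b} a b' b'≢b rewrite dec-false (b' ≟ b) b'≢b = refl

  rematch-edge : ∀ M a₀ b a b' → rematch M a₀ b a b' ≡ true →
    (b' ≡ b × a ≡ a₀) ⊎ (¬ b' ≡ b × M a b' ≡ true)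
  rematch-edge M a₀ b a b' e with b' ≟ b
  ... | yes refl = inj₁ (refl , dec-true⁻ (a ≟ a₀) e)
  ... | no b'≢b  = inj₂ (b'≢b , e)

  rematch-matching : ∀ {M a₀ b} → IsMatching G M → Unsaturated M a₀ → G a₀ b ≡ true →
    IsMatching G (rematch M a₀ b)
  rematch-matching {M} {a₀} {b} (inG , rows , cols) u g = inG' , rows' , cols'
    where
      inG' : ∀ a b' → rematch M a₀ b a b' ≡ true → G a b' ≡ true
      inG' a b' e with rematch-edge M a₀ b a b' e
      ... | inj₁ (refl , refl) = g
      ... | inj₂ (_ , ab'∈M)   = inG a b' ab'∈M
      rows' : ∀ a b₁ b₂ → rematch M a₀ b a b₁ ≡ true → rematch M a₀ b a b₂ ≡ true → b₁ ≡ b₂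
      rows' a b₁ b₂ e₁ e₂ with rematch-edge M a₀ b a b₁ e₁ | rematch-edge M a₀ b a b₂ e₂
      ... | inj₁ (refl , _)      | inj₁ (refl , _)      = refl
      ... | inj₁ (_ , refl)      | inj₂ (_ , a₀b₂∈M)    = ⊥-elim (u b₂ a₀b₂∈M)
      ... | inj₂ (_ , a₀b₁∈M)    | inj₁ (_ , refl)      = ⊥-elim (u b₁ a₀b₁∈M)
      ... | inj₂ (_ , ab₁∈M)     | inj₂ (_ , ab₂∈M)     = rows a b₁ b₂ ab₁∈M ab₂∈M
      cols' : ∀ a₁ a₂ b' → rematch M a₀ b a₁ b' ≡ true → rematch M a₀ b a₂ b' ≡ true → a₁ ≡ a₂
      cols' a₁ a₂ b' e₁ e₂ with rematch-edge M a₀ b a₁ b' e₁ | rematch-edge M a₀ b a₂ b' e₂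
      ... | inj₁ (_ , refl)      | inj₁ (_ , refl)      = refl
      ... | inj₁ (refl , _)      | inj₂ (b≢b , _)       = ⊥-elim (b≢b refl)
      ... | inj₂ (b≢b , _)       | inj₁ (refl , _)      = ⊥-elim (b≢b refl)
      ... | inj₂ (_ , a₁b'∈M)    | inj₂ (_ , a₂b'∈M)    = cols a₁ a₂ b' a₁b'∈M a₂b'∈M

  rematch-saturates : ∀ M a₀ b → saturated (rematch M a₀ b) a₀ ≡ true
  rematch-saturates M a₀ b = anyB-intro b (trans (rematch-at M a₀ b a₀) (dec-true (a₀ ≟ a₀) refl))

  rematch-keeps : ∀ M a₀ b a → ¬ a ≡ a₀ → ¬ M a b ≡ true →
    saturated (rematch M a₀ b) a ≡ saturated M a
  rematch-keeps M a₀ b a a≢a₀ ab∉M = anyB-cong same-row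
    where
      same-row : ∀ b' → rematch M a₀ b a b' ≡ M a b'
      same-row b' with b' ≟ b
      ... | yes refl = trans (dec-false (a ≟ a₀) a≢a₀) (sym (¬-not ab∉M))
      ... | no _     = refl

  rematch-grows : ∀ {M a₀ b} → Unsaturated M a₀ → UnsaturatedB M b →
    matchSize (rematch M a₀ b) ≡ suc (matchSize M)
  rematch-grows {M} {a₀} {b} u free = count-insert a₀ (anyB-none u) (rematch-saturates M a₀ b)
    (λ a a≢a₀ → sym (rematch-keeps M a₀ b a a≢a₀ (free a)))

  rematch-moves : ∀ {M a₀ a₁ b} → IsMatching G M → Unsaturated M a₀ → M a₁ b ≡ true →
    Unsaturated (rematch M a₀ b) a₁ × matchSize (rematch M a₀ b) ≡ matchSize M
  rematch-moves {M} {a₀} {a₁} {b} (_ , rows , cols) u a₁b∈M = u₁ ,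
    sym (count-swap a₀ a₁ (anyB-none u) (rematch-saturates M a₀ b) (anyB-intro b a₁b∈M) (anyB-none u₁)
      (λ a a≢a₀ a≢a₁ → sym (rematch-keeps M a₀ b a a≢a₀ (λ ab∈M → a≢a₁ (cols a a₁ b ab∈M a₁b∈M)))))
    where
      u₁ : Unsaturated (rematch M a₀ b) a₁
      u₁ b' e with rematch-edge M a₀ b a₁ b' e
      ... | inj₁ (_ , refl)      = u b a₁b∈M
      ... | inj₂ (b'≢b , a₁b'∈M) = b'≢b (rows a₁ b' b a₁b'∈M a₁b∈M)

  steps-rematch : ∀ {M a₀ b} xs → Steps M xs → All (λ y → ¬ inj₂ b ≡ y) xs → Steps (rematch M a₀ b) xs
  steps-rematch []                      _               _              = tt
  steps-rematch (x ∷ [])                _               _              = tt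
  steps-rematch {M} {a₀} (inj₁ a ∷ inj₂ b' ∷ r) ((g , ∉M) , ss) (_ ∷ b≢b' ∷ avoid) =
    (g , ∉M ∘ trans (sym (rematch-off M a₀ a b' (b≢b' ∘ cong inj₂ ∘ sym)))) ,
    steps-rematch (inj₂ b' ∷ r) ss (b≢b' ∷ avoid)
  steps-rematch {M} {a₀} (inj₂ b' ∷ inj₁ a ∷ r) ((g , ∈M) , ss) (b≢b' ∷ a≢ ∷ avoid) =
    (g , trans (rematch-off M a₀ a b' (b≢b' ∘ cong inj₂ ∘ sym)) ∈M) ,
    steps-rematch (inj₁ a ∷ r) ss (a≢ ∷ avoid)
  steps-rematch (inj₁ _ ∷ inj₁ _ ∷ _) (() , _) _
  steps-rematch (inj₂ _ ∷ inj₂ _ ∷ _) (() , _) _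

  -- Each B-vertex of the path is
  -- rematched to its predecessor in turn; only the last one grows the matching.
  augment : ∀ {M a₀ b} r → IsMatching G M → Unsaturated M a₀ → AltPath M (inj₁ a₀) (inj₂ b) r →
    UnsaturatedB M b → ∃[ M' ] (IsMatching G M' × matchSize M' ≡ suc (matchSize M))
  augment [] _ _ (_ , () , _) _
  augment (inj₁ _ ∷ _) _ _ ((() , _) , _) _
  augment (inj₂ _ ∷ inj₂ _ ∷ _) _ _ ((_ , () , _) , _) _
  augment {M} {a₀} (inj₂ b₁ ∷ []) mat u (((g , _) , _) , refl , _) free =
    rematch M a₀ b₁ , rematch-matching mat u g , rematch-grows u free
  augment {M} {a₀} {b} (inj₂ b₁ ∷ inj₁ a₁ ∷ r) mat u
          (((g , _) , (_ , a₁b₁∈M) , ss) , e , _ ∷ b₁∉ ∷ uniq) free =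
    let M' , mat' , grows = augment r (rematch-matching mat u g) (proj₁ moved) rest b-free in
    M' , mat' , trans grows (cong suc (proj₂ moved))
    where
      -- Rematching b₁ to a₀ frees a₁, which starts the rest of the path.
      moved : Unsaturated (rematch M a₀ b₁) a₁ × matchSize (rematch M a₀ b₁) ≡ matchSize M
      moved = rematch-moves mat u a₁b₁∈M
      rest : AltPath (rematch M a₀ b₁) (inj₁ a₁) (inj₂ b) r
      rest = steps-rematch (inj₁ a₁ ∷ r) ss b₁∉ , e , uniq
      b≢b₁ : ¬ b ≡ b₁
      b≢b₁ refl = All.lookup b₁∉ (endsAt-member (inj₁ a₁ ∷ r) e) refl
      b-free : UnsaturatedB (rematch M a₀ b₁) b
      b-free a e' = free a (trans (sym (rematch-off M a₀ a b b≢b₁)) e')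

  -- M admits no augmenting path: every reachable B-vertex is saturated.
  AugmentingFree : EdgeSet m n → Set
  AugmentingFree M = ∀ b → Reachable M (inj₂ b) → ∃[ a ] M a b ≡ true

  -- Augmenting from the empty matching terminates, since the size grows and stays below m.
  augmenting-free : ∃[ M ] (IsMatching G M × AugmentingFree M)
  augmenting-free = improve m (λ _ _ → false) ((λ _ _ ()) , (λ _ _ _ ()) , (λ _ _ _ ())) (m≤m+n m _)
    where
      -- Either no free B-vertex is reachable, or a path to one augments M; since |M| ≤ m,
      -- the fuel (with fuel + |M| ≥ m) runs out only if augmentation is impossible.
      improve : ∀ fuel M → IsMatching G M → m ≤ fuel + matchSize M →
        ∃[ M' ] (IsMatching G M' × AugmentingFree M')
      improve fuel M mat bound
        with any? (λ b → reachable-within? M (inj₂ b) ×-dec all? (λ a → ¬? (M a b Bool.≟ true)))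
      ... | no none = M , mat , saturated-ends
        where
          saturated-ends : AugmentingFree M
          saturated-ends b reach with any? (λ a → M a b Bool.≟ true)
          ... | yes ab∈M  = ab∈M
          ... | no b-free = ⊥-elim (none (b , reachable-within reach , λ a ab∈M → b-free (a , ab∈M)))
      ... | yes (b , (a₀ , u , w) , free) with walk→path w
      ...   | r , path with augment r mat u path free | fuel
      ...     | M' , mat' , grows | zero =
        ⊥-elim (1+n≰n (≤-trans (≤-reflexive (sym grows)) (≤-trans (count-≤ (saturated M')) bound)))
      ...     | M' , mat' , grows | suc fuel' =
        improve fuel' M' mat' (≤-trans bound (≤-reflexive (trans (sym (+-suc fuel' _)) (cong (fuel' +_) (sym grows)))))

module KonigCovers {m n : ℕ} (G : BipGraph m n) where
  open Duality G
  open Walks G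
  open TightCovers G
  open Augmentation G

  reach : EdgeSet m n → V → Bool
  reach M z = does (reachable-within? M z)

  reach⁻ : ∀ {M z} → reach M z ≡ true → Reachable M z
  reach⁻ {M} {z} e with dec-true⁻ (reachable-within? M z) e
  ... | a₀ , u , w = a₀ , u , m + n , w

  reach⁺ : ∀ {M z} → Reachable M z → reach M z ≡ true
  reach⁺ r = dec-true (reachable-within? _ _) (reachable-within r)

  unsaturated-reachable : ∀ {M a} → saturated M a ≡ false → Reachable M (inj₁ a)
  unsaturated-reachable s = _ , (λ b ab∈M → case trans (sym s) (anyB-intro b ab∈M) of λ ()) , 0 , []

  konig : EdgeSet m n → VSet m n
  konig M = tabulate (λ a → saturated M a ∧ not (reach M (inj₁ a))) , tabulate (λ b → reach M (inj₂ b))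

  -- A matched A-vertex off every alternating path is not reachable, so it is in the cover.
  konig-A : ∀ {M a b} → IsMatching G M → M a b ≡ true → ¬ OnAltPath G M a b → a ∈ proj₁ (konig M)
  konig-A {M} {a} {b} mat ab∈M off = tabulate-∈ (∧-true⁺ (anyB-intro {f = M a} b ab∈M)
    (not-true⁺ (λ r → off (reachable⇒onAltPath mat (reach⁻ r) ab∈M))))

  -- An edge is covered at B if its A-end is reachable, and at A otherwise.
  konig-covers : ∀ {M} → IsMatching G M → IsVertexCover G (konig M)
  konig-covers {M} mat a b g with reach M (inj₁ a) in r
  ... | true = inj₂ (tabulate-∈ (reach⁺ (continue (reach⁻ r))))
    where
      continue : Reachable M (inj₁ a) → Reachable M (inj₂ b)
      continue ra with M a b Bool.≟ true
      ... | yes ab∈M = mate-reachable mat ra ab∈M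
      ... | no ab∉M  = reachable-step ra (g , ab∉M)
  ... | false with saturated M a in s
  ...   | true  = inj₁ (tabulate-∈ (∧-true⁺ s (cong not r)))
  ...   | false = case trans (sym r) (reach⁺ (unsaturated-reachable s)) of λ ()

  konig-partner : ∀ {M b} → IsMatching G M → AugmentingFree M → b ∈ proj₂ (konig M) →
    ∃[ a ] (M a b ≡ true × Reachable M (inj₁ a))
  konig-partner {b = b} (inG , _) free b∈ with reach⁻ (∈-tabulate b∈)
  ... | rb with free b rb
  ...   | a , ab∈M = a , ab∈M , reachable-step rb (inG a b ab∈M , ab∈M)

  konig-small : ∀ {M} → IsMatching G M → AugmentingFree M → size (konig M) ≤ matchSize M
  konig-small {M} mat free = matched-bound mat A-saturated B-matched
    where
      A-saturated : ∀ a → a ∈ proj₁ (konig M) → ∃[ b ] M a b ≡ true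
      A-saturated a a∈ = anyB-elim (proj₁ (∧-true⁻ (∈-tabulate a∈)))
      B-matched : ∀ b → b ∈ proj₂ (konig M) → ∃[ a ] (M a b ≡ true × ¬ a ∈ proj₁ (konig M))
      B-matched b b∈ with konig-partner mat free b∈
      ... | a , ab∈M , ra =
        a , ab∈M , λ a∈ → not-true⁻ (proj₂ (∧-true⁻ (∈-tabulate a∈))) (reach⁺ ra)

  konig-minimum : ∀ {M} → IsMatching G M → AugmentingFree M → IsMinimumVertexCover G (konig M)
  konig-minimum mat free = konig-covers mat , λ C' cov' → ≤-trans (konig-small mat free) (weak-duality mat cov')

  konig-maximum : ∀ {M} → IsMatching G M → AugmentingFree M → IsMaximumMatching G M
  konig-maximum {M} mat free = mat , λ M' mat' → begin
    edgeCount M'     ≡⟨ edgeCount≡matchSize mat' ⟩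
    matchSize M'     ≤⟨ weak-duality mat' (konig-covers mat) ⟩
    size (konig M)   ≤⟨ konig-small mat free ⟩
    matchSize M      ≡⟨ edgeCount≡matchSize mat ⟨
    edgeCount M      ∎
    where open ≤-Reasoning

  konigFrom-small : ∀ {M C} → IsMatching G M → IsAKonigCoverFrom G M C → size C ≤ matchSize M
  konigFrom-small {M} {C@(CA , CB)} mat@(_ , rows , _) (A-rule , B-rule) =
    matched-bound mat A-saturated B-matched
    where
      off-path : ∀ {a b} → a ∈ CA → M a b ≡ true → ¬ OnAltPath G M a b
      off-path {a} a∈ ab∈M with Equivalence.to (A-rule a) a∈
      ... | b' , ab'∈M , off rewrite rows a _ b' ab∈M ab'∈M = off
      A-saturated : ∀ a → a ∈ CA → ∃[ b ] M a b ≡ true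
      A-saturated a a∈ = let b , ab∈M , _ = Equivalence.to (A-rule a) a∈ in b , ab∈M
      B-matched : ∀ b → b ∈ CB → ∃[ a ] (M a b ≡ true × ¬ a ∈ CA)
      B-matched b b∈ = let a , ab∈M , on = Equivalence.to (B-rule b) b∈ in
        a , ab∈M , λ a∈ → off-path a∈ ab∈M on

  -- A minimum cover no larger than an A-König cover is tight with its matching, so it
  -- contains less of A and more of B than the A-König cover does.
  konig-extremal : ∀ {M C C'} → IsMatching G M → IsAKonigCoverFrom G M C → IsVertexCover G C →
    IsMinimumVertexCover G C' → (proj₁ C' ⊆ proj₁ C) × (proj₂ C ⊆ proj₂ C')
  konig-extremal {M} {C} {C'} mat (A-rule , B-rule) cov (cov' , min') = A-part , B-part
    where
      t : Tight M C'
      t = tight mat cov' (≤-trans (min' C cov) (konigFrom-small mat (A-rule , B-rule)))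
      A-part : proj₁ C' ⊆ proj₁ C
      A-part {a} a∈ = Equivalence.from (A-rule a) (tight-A t cov' a∈)
      B-part : proj₂ C ⊆ proj₂ C'
      B-part {b} b∈ = tight-B t cov' (proj₂ (proj₂ (Equivalence.to (B-rule b) b∈)))

  -- Conversely, a minimum cover lying between every minimum cover in this way is the
  -- A-König cover of an augmenting-path free matching M: it is tight with M, and
  -- it is squeezed against König's cover of M.
  extremal-konig : ∀ {C} → IsMinimumVertexCover G C →
    (∀ C' → IsMinimumVertexCover G C' → (proj₁ C' ⊆ proj₁ C) × (proj₂ C ⊆ proj₂ C')) →
    IsAKonigCover G C
  extremal-konig {C} (cov , min) extremal with augmenting-free
  ... | M , mat , free =
    M , konig-maximum mat free , (λ a → mk⇔ (A⇒ a) (A⇐ a)) , (λ b → mk⇔ (B⇒ b) (B⇐ b))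
    where
      t : Tight M C
      t = tight mat cov (≤-trans (min (konig M) (konig-covers mat)) (konig-small mat free))
      squeeze : (proj₁ (konig M) ⊆ proj₁ C) × (proj₂ C ⊆ proj₂ (konig M))
      squeeze = extremal (konig M) (konig-minimum mat free)
      A⇒ : ∀ a → a ∈ proj₁ C → ∃[ b ] (M a b ≡ true × ¬ OnAltPath G M a b)
      A⇒ a = tight-A t cov
      A⇐ : ∀ a → ∃[ b ] (M a b ≡ true × ¬ OnAltPath G M a b) → a ∈ proj₁ C
      A⇐ a (b , ab∈M , off) = proj₁ squeeze (konig-A mat ab∈M off)
      B⇒ : ∀ b → b ∈ proj₂ C → ∃[ a ] (M a b ≡ true × OnAltPath G M a b)
      B⇒ b b∈ = let a , ab∈M , ra = konig-partner mat free (proj₂ squeeze b∈) in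
        a , ab∈M , reachable⇒onAltPath mat ra ab∈M
      B⇐ : ∀ b → ∃[ a ] (M a b ≡ true × OnAltPath G M a b) → b ∈ proj₂ C
      B⇐ b (a , _ , on) = tight-B t cov on

lemma2 : ∀ {m n} (G : BipGraph m n) (C : VSet m n) → IsMinimumVertexCover G C →
    (IsAKonigCover G C ⇔
      (∀ C' → IsMinimumVertexCover G C' → (proj₁ C' ⊆ proj₁ C) × (proj₂ C ⊆ proj₂ C')))
lemma2 G C minC@(cov , _) = mk⇔
  (λ (M , (mat , _) , fromM) C' minC' → konig-extremal mat fromM cov minC')
  (extremal-konig minC)
  where open KonigCovers G
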